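{- Let $n$ be a positive integer and let $G$ be an $n$-monophilic graph. Suppose the vertices $v_1,\dots,v_k$ of $G$ induce a complete subgraph of $G$. Let $G'$ be the graph obtained from $G$ by adding one new vertex and joining it by edges to exactly $v_1,\dots,v_k$. Then $G'$ is $n$-monophilic.
   Context: All graphs are finite and simple. A list assignment for a graph $G$ is a function $L$ assigning to each vertex $v$ a finite set $L(v)\subseteq\mathbb{N}$ of colors; it is an $n$-list assignment if $|L(v)|=n$ for all $v$. A (proper) coloring of $G$ from $L$ is a map $\gamma$ on $V(G)$ with $\gamma(v)\in L(v)$ for all $v$ and $\gamma(v)\neq\gamma(w)$ for adjacent $v,w$. $\mathrm{col}(G,L)$ is the number of colorings of $G$ from $L$, and $\mathrm{col}(G,n)$ denotes $\mathrm{col}(G,L)$ when $L(v)=\{1,\dots,n\}$ for all $v$. $G$ is $n$-monophilic if $\mathrm{col}(G,n)\le\mathrm{col}(G,L)$ for every $n$-list assignment $L$ for $G$. -}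

module Defs where

open import Data.Nat using (ℕ; zero; suc; _≤_)
open import Data.Bool using (Bool; true; false; _∧_; not)
open import Data.Fin using (Fin; zero; suc)
open import Data.List using (List; []; _∷_; map; concatMap; length; upTo; allFin; filterᵇ)
open import Data.Bool.ListAction using (all)
open import Data.List.Relation.Unary.Unique.Propositional using (Unique)
open import Data.Vec.Functional using (Vector) renaming (_∷_ to _∷ᵛ_)
open import Data.Product using (_×_)
open import Relation.Binary.PropositionalEquality using (_≡_; _≢_)
open import Relation.Nullary.Decidable using (⌊_⌋)
import Data.Nat as ℕ

record Graph : Set where
  field
    size   : ℕ
    adj    : Fin size → Fin size → Bool
    symm   : ∀ i j → adj i j ≡ adj j i
    noLoop : ∀ i → adj i i ≡ false
open Graph public

ListAssignment : Graph → Set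
ListAssignment G = Fin (size G) → List ℕ

IsNListAssignment : ℕ → (G : Graph) → ListAssignment G → Set
IsNListAssignment n G L = ∀ v → Unique (L v) × length (L v) ≡ n

-- All maps γ with γ(v) ∈ L(v) for all v (each exactly once, when the L(v) are duplicate-free).
choices : (m : ℕ) → (Fin m → List ℕ) → List (Vector ℕ m)
choices zero    L = (λ ()) ∷ []
choices (suc m) L = concatMap (λ c → map (λ f → c ∷ᵛ f) (choices m (λ i → L (suc i)))) (L zero)

isProper : (G : Graph) → Vector ℕ (size G) → Bool
isProper G γ = all (λ i → all (λ j → not (adj G i j) Data.Bool.∨ not ⌊ γ i ℕ.≟ γ j ⌋) (allFin (size G))) (allFin (size G))

col : (G : Graph) → ListAssignment G → ℕ
col G L = length (filterᵇ (isProper G) (choices (size G) L))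

standard : ℕ → (G : Graph) → ListAssignment G
standard n G v = map suc (upTo n)

colN : Graph → ℕ → ℕ
colN G n = col G (standard n G)

Monophilic : ℕ → Graph → Set
Monophilic n G = ∀ (L : ListAssignment G) → IsNListAssignment n G L → colN G n ≤ col G L

IsClique : (G : Graph) → (Fin (size G) → Bool) → Set
IsClique G S = ∀ i j → S i ≡ true → S j ≡ true → i ≢ j → adj G i j ≡ true

-- G' : add a new vertex (index zero; old vertex i becomes suc i) adjacent exactly to S.
addVertexAdj : (G : Graph) → (Fin (size G) → Bool) → Fin (suc (size G)) → Fin (suc (size G)) → Bool
addVertexAdj G S zero    zero    = false
addVertexAdj G S zero    (suc j) = S j
addVertexAdj G S (suc i) zero    = S i
addVertexAdj G S (suc i) (suc j) = adj G i j

addVertexSym : (G : Graph) (S : Fin (size G) → Bool) → ∀ i j → addVertexAdj G S i j ≡ addVertexAdj G S j i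
addVertexSym G S zero    zero    = Relation.Binary.PropositionalEquality.refl
addVertexSym G S zero    (suc j) = Relation.Binary.PropositionalEquality.refl
addVertexSym G S (suc i) zero    = Relation.Binary.PropositionalEquality.refl
addVertexSym G S (suc i) (suc j) = symm G i j

addVertexLoop : (G : Graph) (S : Fin (size G) → Bool) → ∀ i → addVertexAdj G S i i ≡ false
addVertexLoop G S zero    = Relation.Binary.PropositionalEquality.refl
addVertexLoop G S (suc i) = noLoop G i

addVertex : (G : Graph) → (Fin (size G) → Bool) → Graph
addVertex G S = record
  { size = suc (size G) ; adj = addVertexAdj G S
  ; symm = addVertexSym G S ; noLoop = addVertexLoop G S }

-- Colour the old vertices first.  A colouring γ of G from L extends to the new
-- vertex v exactly by the colours of L(v) avoiding the colours γ puts on the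
-- clique S, so col(G', L) = Σ_γ #(L(v) ∖ γ(S)).  Since γ(S) has at most |S|
-- colours, each term is at least n − |S|; for the standard lists a proper γ is
-- injective on the clique S and uses colours from {1,…,n}, so each term is at
-- most n − |S|.  Hence col(G', n) ≤ col(G, n)(n − |S|) ≤ col(G, L)(n − |S|) ≤ col(G', L).
module Submission where

open import Defs
open import Data.Nat using (ℕ; _≥_; zero; suc; _+_; _*_; _∸_; _≤_; z≤n; s≤s)
open import Data.Nat.Properties
open import Algebra.Properties.CommutativeSemigroup +-commutativeSemigroup using (interchange)
open import Data.Bool using (Bool; true; false; _∧_; _∨_; not; if_then_else_; T)
open import Data.Bool.Properties using (T-≡; ∧-zeroʳ)
open import Data.Bool.ListAction using (all; and)
open import Data.Fin using (Fin; zero; suc)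
open import Data.List using (List; []; _∷_; map; concatMap; length; upTo; allFin; filterᵇ; _++_; tabulate)
open import Data.List.Properties using (map-tabulate; map-cong; length-map; length-upTo)
open import Data.List.Relation.Unary.All using (All; []; _∷_)
import Data.List.Relation.Unary.All as All
open import Data.List.Relation.Unary.All.Properties using (all⁺; concat⁺; map⁺; all-filter; filter⁺)
open import Data.List.Relation.Unary.Any using (here; there)
open import Data.List.Membership.Propositional using (_∈_)
open import Data.List.Membership.Propositional.Properties using (∈-allFin; ∈-map⁻)
open import Data.List.Relation.Unary.AllPairs using ([]; _∷_)
open import Data.List.Relation.Unary.Unique.Propositional using (Unique)
import Data.List.Relation.Unary.Unique.Propositional.Properties as Unique
open import Data.Vec.Functional using (Vector) renaming (_∷_ to _∷ᵛ_)
open import Data.Product using (_×_; _,_; proj₁; proj₂)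
open import Function using (_∘_; Equivalence)
open import Relation.Binary.Definitions using (DecidableEquality)
open import Relation.Binary.PropositionalEquality
open import Relation.Nullary using (yes; no)
open import Relation.Nullary.Decidable using (⌊_⌋; T?; dec-true; dec-false; isYes≗does)
import Data.Nat as ℕ

private
  variable
    X Y : Set

∑ : List X → (X → ℕ) → ℕ
∑ []       g = 0
∑ (x ∷ xs) g = g x + ∑ xs g

syntax ∑ xs (λ x → e) = ∑[ x ∈ xs ] e

⟦_⟧ : Bool → ℕ
⟦ b ⟧ = if b then 1 else 0

count : (X → Bool) → List X → ℕ
count p xs = ∑[ x ∈ xs ] ⟦ p x ⟧

⟦∧⟧ : ∀ a b → ⟦ a ∧ b ⟧ ≡ ⟦ a ⟧ * ⟦ b ⟧
⟦∧⟧ true  b = sym (+-identityʳ ⟦ b ⟧)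
⟦∧⟧ false b = refl

⟦⟧*-monoʳ-≤ : ∀ b {x y} → (b ≡ true → x ≤ y) → ⟦ b ⟧ * x ≤ ⟦ b ⟧ * y
⟦⟧*-monoʳ-≤ true  x≤y = +-monoˡ-≤ 0 (x≤y refl)
⟦⟧*-monoʳ-≤ false _   = z≤n

∑-cong : (xs : List X) {g h : X → ℕ} → (∀ x → g x ≡ h x) → ∑ xs g ≡ ∑ xs h
∑-cong []       g≗h = refl
∑-cong (x ∷ xs) g≗h = cong₂ _+_ (g≗h x) (∑-cong xs g≗h)

∑-mono : (xs : List X) {g h : X → ℕ} → All (λ x → g x ≤ h x) xs → ∑ xs g ≤ ∑ xs h
∑-mono []       []           = z≤n
∑-mono (x ∷ xs) (gx≤hx ∷ le) = +-mono-≤ gx≤hx (∑-mono xs le)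

∑-+ : (xs : List X) (g h : X → ℕ) → ∑[ x ∈ xs ] (g x + h x) ≡ ∑ xs g + ∑ xs h
∑-+ []       g h = refl
∑-+ (x ∷ xs) g h =
  trans (cong (g x + h x +_) (∑-+ xs g h)) (interchange (g x) (h x) (∑ xs g) (∑ xs h))

∑-*ˡ : (xs : List X) (c : ℕ) (g : X → ℕ) → ∑[ x ∈ xs ] (c * g x) ≡ c * ∑ xs g
∑-*ˡ []       c g = sym (*-zeroʳ c)
∑-*ˡ (x ∷ xs) c g = trans (cong (c * g x +_) (∑-*ˡ xs c g)) (sym (*-distribˡ-+ c (g x) (∑ xs g)))

∑-*ʳ : (xs : List X) (g : X → ℕ) (c : ℕ) → ∑[ x ∈ xs ] (g x * c) ≡ ∑ xs g * c
∑-*ʳ xs g c = begin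
  ∑[ x ∈ xs ] (g x * c) ≡⟨ ∑-cong xs (λ x → *-comm (g x) c) ⟩
  ∑[ x ∈ xs ] (c * g x) ≡⟨ ∑-*ˡ xs c g ⟩
  c * ∑ xs g            ≡⟨ *-comm c (∑ xs g) ⟩
  ∑ xs g * c            ∎
  where open ≡-Reasoning

∑-map : (xs : List X) (f : X → Y) (g : Y → ℕ) → ∑ (map f xs) g ≡ ∑ xs (g ∘ f)
∑-map []       f g = refl
∑-map (x ∷ xs) f g = cong (g (f x) +_) (∑-map xs f g)

∑-++ : (xs ys : List X) (g : X → ℕ) → ∑ (xs ++ ys) g ≡ ∑ xs g + ∑ ys g
∑-++ []       ys g = refl
∑-++ (x ∷ xs) ys g = trans (cong (g x +_) (∑-++ xs ys g)) (sym (+-assoc (g x) _ _))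

∑-concatMap : (xs : List X) (k : X → List Y) (g : Y → ℕ) →
  ∑ (concatMap k xs) g ≡ ∑[ x ∈ xs ] ∑ (k x) g
∑-concatMap []       k g = refl
∑-concatMap (x ∷ xs) k g =
  trans (∑-++ (k x) (concatMap k xs) g) (cong (∑ (k x) g +_) (∑-concatMap xs k g))

∑-zero : (xs : List X) → ∑[ x ∈ xs ] 0 ≡ 0
∑-zero []       = refl
∑-zero (x ∷ xs) = ∑-zero xs

∑-swap : (xs : List X) (ys : List Y) (e : X → Y → ℕ) →
  ∑[ x ∈ xs ] ∑ ys (e x) ≡ ∑[ y ∈ ys ] ∑[ x ∈ xs ] e x y
∑-swap []       ys e = sym (∑-zero ys)
∑-swap (x ∷ xs) ys e = trans (cong (∑ ys (e x) +_) (∑-swap xs ys e)) (sym (∑-+ ys (e x) _))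

length-filterᵇ : (p : X → Bool) (xs : List X) → length (filterᵇ p xs) ≡ count p xs
length-filterᵇ p []       = refl
length-filterᵇ p (x ∷ xs) with p x
... | true  = cong suc (length-filterᵇ p xs)
... | false = length-filterᵇ p xs

count-split : (e q : X → Bool) (xs : List X) →
  count q xs ≡ count (λ x → not (e x) ∧ q x) xs + count (λ x → e x ∧ q x) xs
count-split e q xs = trans (∑-cong xs split) (∑-+ xs _ _)
  where
  split : ∀ x → ⟦ q x ⟧ ≡ ⟦ not (e x) ∧ q x ⟧ + ⟦ e x ∧ q x ⟧
  split x with e x
  ... | true  = refl
  ... | false = sym (+-identityʳ _)

count-true : (xs : List X) → count (λ _ → true) xs ≡ length xs
count-true []       = refl
count-true (x ∷ xs) = cong suc (count-true xs)

count-none : (p : X → Bool) {xs : List X} → All (λ x → p x ≡ false) xs → count p xs ≡ 0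
count-none p []           = refl
count-none p (px≡f ∷ pxs) rewrite px≡f = count-none p pxs

module Fresh {A : Set} (_≟_ : DecidableEquality A) where

  fresh : List A → A → Bool
  fresh bs c = all (λ b → not ⌊ c ≟ b ⌋) bs

  ⌊≟⌋-true : ∀ {a b} → a ≡ b → ⌊ a ≟ b ⌋ ≡ true
  ⌊≟⌋-true {a} {b} a≡b = trans (isYes≗does (a ≟ b)) (dec-true (a ≟ b) a≡b)

  ⌊≟⌋-false : ∀ {a b} → a ≢ b → ⌊ a ≟ b ⌋ ≡ false
  ⌊≟⌋-false {a} {b} a≢b = trans (isYes≗does (a ≟ b)) (dec-false (a ≟ b) a≢b)

  ⌊≟⌋-sym : ∀ a b → ⌊ a ≟ b ⌋ ≡ ⌊ b ≟ a ⌋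
  ⌊≟⌋-sym a b with a ≟ b
  ... | yes a≡b = sym (⌊≟⌋-true (sym a≡b))
  ... | no  a≢b = sym (⌊≟⌋-false (a≢b ∘ sym))

  fresh-≢ : ∀ {c bs} → All (c ≢_) bs → fresh bs c ≡ true
  fresh-≢ []                   = refl
  fresh-≢ {c} (_∷_ {b} c≢b c≢bs) rewrite ⌊≟⌋-false c≢b = fresh-≢ c≢bs

  count-≟-none : ∀ {x xs} (q : A → Bool) → All (x ≢_) xs →
    count (λ c → ⌊ c ≟ x ⌋ ∧ q c) xs ≡ 0
  count-≟-none {x} q x≢xs = count-none _ (All.map unequal x≢xs)
    where
    unequal : ∀ {y} → x ≢ y → ⌊ y ≟ x ⌋ ∧ q y ≡ false
    unequal {y} x≢y rewrite ⌊≟⌋-false (x≢y ∘ sym) = refl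

  count-≟-≤1 : ∀ {xs} (b : A) (q : A → Bool) → Unique xs →
    count (λ c → ⌊ c ≟ b ⌋ ∧ q c) xs ≤ 1
  count-≟-≤1 b q [] = z≤n
  count-≟-≤1 {x ∷ xs} b q (x≢xs ∷ u) with x ≟ b
  ... | no  _    = count-≟-≤1 b q u
  ... | yes refl rewrite count-≟-none q x≢xs with q x
  ...   | true  = s≤s z≤n
  ...   | false = z≤n

  count-≟-≥1 : ∀ {b xs} (q : A → Bool) → b ∈ xs → q b ≡ true →
    1 ≤ count (λ c → ⌊ c ≟ b ⌋ ∧ q c) xs
  count-≟-≥1 {b} q (here refl) qb rewrite ⌊≟⌋-true (refl {x = b}) | qb = s≤s z≤n
  count-≟-≥1 {b} {x ∷ _} q (there b∈xs) qb =
    ≤-trans (count-≟-≥1 q b∈xs qb) (m≤n+m _ ⟦ ⌊ x ≟ b ⌋ ∧ q x ⟧)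

  count-fresh-∷ : ∀ b bs xs →
    count (fresh bs) xs ≡ count (fresh (b ∷ bs)) xs + count (λ c → ⌊ c ≟ b ⌋ ∧ fresh bs c) xs
  count-fresh-∷ b bs = count-split (λ c → ⌊ c ≟ b ⌋) (fresh bs)

  length≤length+count-fresh : ∀ {xs} → Unique xs → ∀ bs →
    length xs ≤ length bs + count (fresh bs) xs
  length≤length+count-fresh {xs} u [] = ≤-reflexive (sym (count-true xs))
  length≤length+count-fresh {xs} u (b ∷ bs) = begin
    length xs                        ≤⟨ length≤length+count-fresh u bs ⟩
    length bs + count (fresh bs) xs  ≡⟨ cong (length bs +_) (count-fresh-∷ b bs xs) ⟩
    length bs + (F + E)              ≤⟨ +-monoʳ-≤ (length bs) (+-monoʳ-≤ F (count-≟-≤1 b (fresh bs) u)) ⟩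
    length bs + (F + 1)              ≡⟨ cong (length bs +_) (+-comm F 1) ⟩
    length bs + suc F                ≡⟨ +-suc (length bs) F ⟩
    length (b ∷ bs) + F              ∎
    where
    open ≤-Reasoning
    F E : ℕ
    F = count (fresh (b ∷ bs)) xs
    E = count (λ c → ⌊ c ≟ b ⌋ ∧ fresh bs c) xs

  count-fresh+length≤length : ∀ {xs bs} → Unique bs → (∀ {b} → b ∈ bs → b ∈ xs) →
    count (fresh bs) xs + length bs ≤ length xs
  count-fresh+length≤length {xs} [] _ = ≤-reflexive (trans (+-identityʳ _) (count-true xs))
  count-fresh+length≤length {xs} {b ∷ bs} (b∉bs ∷ u) bs⊆xs = begin
    F + length (b ∷ bs)              ≡⟨ +-suc F (length bs) ⟩
    suc F + length bs                ≡⟨ cong (_+ length bs) (+-comm 1 F) ⟩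
    (F + 1) + length bs              ≤⟨ +-monoˡ-≤ (length bs) (+-monoʳ-≤ F b-allowed) ⟩
    (F + E) + length bs              ≡⟨ cong (_+ length bs) (count-fresh-∷ b bs xs) ⟨
    count (fresh bs) xs + length bs  ≤⟨ count-fresh+length≤length u (bs⊆xs ∘ there) ⟩
    length xs                        ∎
    where
    open ≤-Reasoning
    F E : ℕ
    F = count (fresh (b ∷ bs)) xs
    E = count (λ c → ⌊ c ≟ b ⌋ ∧ fresh bs c) xs
    b-allowed : 1 ≤ E
    b-allowed = count-≟-≥1 (fresh bs) (bs⊆xs (here refl)) (fresh-≢ b∉bs)

open Fresh ℕ._≟_

all-tabulate : ∀ {n} (p : X → Bool) (g : Fin n → X) → all p (tabulate g) ≡ all (p ∘ g) (allFin n)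
all-tabulate p g = trans (cong and (map-tabulate g p)) (sym (cong and (map-tabulate (λ i → i) (p ∘ g))))

all-∧ : (p q : X → Bool) (xs : List X) → all (λ x → p x ∧ q x) xs ≡ all p xs ∧ all q xs
all-∧ p q []       = refl
all-∧ p q (x ∷ xs) rewrite all-∧ p q xs with p x | q x
... | true  | true  = refl
... | true  | false = sym (∧-zeroʳ (all p xs))
... | false | _     = refl

isProper⇒≢ : (G : Graph) {γ : Vector ℕ (size G)} → isProper G γ ≡ true →
  ∀ {i j} → adj G i j ≡ true → γ i ≢ γ j
isProper⇒≢ G {γ} proper {i} {j} i~j γi≡γj =
  subst T (cong₂ (λ a b → not a ∨ not b) i~j (⌊≟⌋-true γi≡γj)) entry
  where
  entry : T (not (adj G i j) ∨ not ⌊ γ i ℕ.≟ γ j ⌋)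
  entry = All.lookup (all⁺ _ _ row) (∈-allFin j)
    where
    row : T (all (λ k → not (adj G i k) ∨ not ⌊ γ i ℕ.≟ γ k ⌋) (allFin (size G)))
    row = All.lookup (all⁺ _ _ (Equivalence.from T-≡ proper)) (∈-allFin i)

∣_∣ : ∀ {m} → (Fin m → Bool) → ℕ
∣ S ∣ = length (filterᵇ S (allFin _))

choices-∈ : (m : ℕ) (L : Fin m → List ℕ) → All (λ γ → ∀ i → γ i ∈ L i) (choices m L)
choices-∈ zero    L = (λ ()) ∷ []
choices-∈ (suc m) L =
  concat⁺ (map⁺ (All.tabulate λ c∈L₀ → map⁺ (All.map (extend c∈L₀) (choices-∈ m (L ∘ suc)))))
  where
  extend : ∀ {c γ} → c ∈ L zero → (∀ i → γ i ∈ L (suc i)) → ∀ i → (c ∷ᵛ γ) i ∈ L i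
  extend c∈L₀ γ∈L zero    = c∈L₀
  extend c∈L₀ γ∈L (suc i) = γ∈L i

module _ (G : Graph) (S : Fin (size G) → Bool) where

  private
    m : ℕ
    m = size G
    G' : Graph
    G' = addVertex G S

  coloursOn : Vector ℕ m → List ℕ
  coloursOn γ = map γ (filterᵇ S (allFin m))

  all-guarded≡fresh : (γ : Vector ℕ m) (c : ℕ) (js : List (Fin m)) →
    all (λ j → not (S j) ∨ not ⌊ c ℕ.≟ γ j ⌋) js ≡ fresh (map γ (filterᵇ S js)) c
  all-guarded≡fresh γ c []       = refl
  all-guarded≡fresh γ c (j ∷ js) with S j
  ... | true  = cong (not ⌊ c ℕ.≟ γ j ⌋ ∧_) (all-guarded≡fresh γ c js)
  ... | false = all-guarded≡fresh γ c js

  isProper-addVertex : (c : ℕ) (γ : Vector ℕ m) →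
    isProper G' (c ∷ᵛ γ) ≡ isProper G γ ∧ fresh (coloursOn γ) c
  isProper-addVertex c γ = begin
    isProper G' (c ∷ᵛ γ)
      ≡⟨ cong₂ _∧_ (all-tabulate (entry zero) suc) (all-tabulate row suc) ⟩
    all toNew (allFin m) ∧ all (λ i → fromNew i ∧ all (entry (suc i)) (tabulate suc)) (allFin m)
      ≡⟨ cong (all toNew (allFin m) ∧_) (cong and (map-cong oldRow (allFin m))) ⟩
    all toNew (allFin m) ∧ all (λ i → toNew i ∧ rowG i) (allFin m)
      ≡⟨ cong (all toNew (allFin m) ∧_) (all-∧ toNew rowG (allFin m)) ⟩
    ok ∧ (ok ∧ isProper G γ)
      ≡⟨ absorb ok (isProper G γ) ⟩
    isProper G γ ∧ ok
      ≡⟨ cong (isProper G γ ∧_) (all-guarded≡fresh γ c (allFin m)) ⟩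
    isProper G γ ∧ fresh (coloursOn γ) c ∎
    where
    open ≡-Reasoning
    entry : Fin (suc m) → Fin (suc m) → Bool
    entry i j = not (adj G' i j) ∨ not ⌊ (c ∷ᵛ γ) i ℕ.≟ (c ∷ᵛ γ) j ⌋
    row : Fin (suc m) → Bool
    row i = all (entry i) (allFin (suc m))
    toNew fromNew : Fin m → Bool
    toNew   j = not (S j) ∨ not ⌊ c ℕ.≟ γ j ⌋
    fromNew i = not (S i) ∨ not ⌊ γ i ℕ.≟ c ⌋
    rowG : Fin m → Bool
    rowG i = all (λ j → not (adj G i j) ∨ not ⌊ γ i ℕ.≟ γ j ⌋) (allFin m)
    ok : Bool
    ok = all toNew (allFin m)
    oldRow : ∀ i → fromNew i ∧ all (entry (suc i)) (tabulate suc) ≡ toNew i ∧ rowG i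
    oldRow i = cong₂ _∧_ (cong (λ b → not (S i) ∨ not b) (⌊≟⌋-sym (γ i) c)) (all-tabulate (entry (suc i)) suc)
    absorb : ∀ a b → a ∧ (a ∧ b) ≡ b ∧ a
    absorb true  true  = refl
    absorb true  false = refl
    absorb false true  = refl
    absorb false false = refl

  col-addVertex : (L' : ListAssignment G') →
    col G' L' ≡ ∑[ γ ∈ choices m (L' ∘ suc) ] (⟦ isProper G γ ⟧ * count (fresh (coloursOn γ)) (L' zero))
  col-addVertex L' = begin
    col G' L'
      ≡⟨ length-filterᵇ (isProper G') (concatMap (λ c → map (c ∷ᵛ_) C) A) ⟩
    count (isProper G') (concatMap (λ c → map (c ∷ᵛ_) C) A)
      ≡⟨ ∑-concatMap A (λ c → map (c ∷ᵛ_) C) _ ⟩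
    ∑[ c ∈ A ] count (isProper G') (map (c ∷ᵛ_) C)
      ≡⟨ ∑-cong A (λ c → trans (∑-map C (c ∷ᵛ_) _) (∑-cong C (split c))) ⟩
    ∑[ c ∈ A ] ∑[ γ ∈ C ] (⟦ isProper G γ ⟧ * ⟦ fresh (coloursOn γ) c ⟧)
      ≡⟨ ∑-swap A C _ ⟩
    ∑[ γ ∈ C ] ∑[ c ∈ A ] (⟦ isProper G γ ⟧ * ⟦ fresh (coloursOn γ) c ⟧)
      ≡⟨ ∑-cong C (λ γ → ∑-*ˡ A ⟦ isProper G γ ⟧ _) ⟩
    ∑[ γ ∈ C ] (⟦ isProper G γ ⟧ * count (fresh (coloursOn γ)) A) ∎
    where
    open ≡-Reasoning
    A : List ℕ
    A = L' zero
    C : List (Vector ℕ m)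
    C = choices m (L' ∘ suc)
    split : ∀ c γ → ⟦ isProper G' (c ∷ᵛ γ) ⟧ ≡ ⟦ isProper G γ ⟧ * ⟦ fresh (coloursOn γ) c ⟧
    split c γ = trans (cong ⟦_⟧ (isProper-addVertex c γ)) (⟦∧⟧ (isProper G γ) _)

  col-scaled : (L : ListAssignment G) (d : ℕ) →
    col G L * d ≡ ∑[ γ ∈ choices m L ] (⟦ isProper G γ ⟧ * d)
  col-scaled L d = trans (cong (_* d) (length-filterᵇ (isProper G) (choices m L)))
                         (sym (∑-*ʳ (choices m L) _ d))

  col-addVertex-≤ : (L' : ListAssignment G') (d : ℕ) →
    (∀ γ → (∀ i → γ i ∈ L' (suc i)) → isProper G γ ≡ true →
      count (fresh (coloursOn γ)) (L' zero) ≤ d) →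
    col G' L' ≤ col G (L' ∘ suc) * d
  col-addVertex-≤ L' d bound = begin
    col G' L'
      ≡⟨ col-addVertex L' ⟩
    ∑[ γ ∈ C ] (⟦ isProper G γ ⟧ * count (fresh (coloursOn γ)) (L' zero))
      ≤⟨ ∑-mono C (All.map (λ {γ} γ∈L → ⟦⟧*-monoʳ-≤ (isProper G γ) (bound γ γ∈L)) (choices-∈ m (L' ∘ suc))) ⟩
    ∑[ γ ∈ C ] (⟦ isProper G γ ⟧ * d)
      ≡⟨ col-scaled (L' ∘ suc) d ⟨
    col G (L' ∘ suc) * d ∎
    where
    open ≤-Reasoning
    C : List (Vector ℕ m)
    C = choices m (L' ∘ suc)

  col-addVertex-≥ : (L' : ListAssignment G') (d : ℕ) →
    (∀ γ → d ≤ count (fresh (coloursOn γ)) (L' zero)) →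
    col G (L' ∘ suc) * d ≤ col G' L'
  col-addVertex-≥ L' d bound = begin
    col G (L' ∘ suc) * d
      ≡⟨ col-scaled (L' ∘ suc) d ⟩
    ∑[ γ ∈ C ] (⟦ isProper G γ ⟧ * d)
      ≤⟨ ∑-mono C (All.universal (λ γ → ⟦⟧*-monoʳ-≤ (isProper G γ) (λ _ → bound γ)) C) ⟩
    ∑[ γ ∈ C ] (⟦ isProper G γ ⟧ * count (fresh (coloursOn γ)) (L' zero))
      ≡⟨ col-addVertex L' ⟨
    col G' L' ∎
    where
    open ≤-Reasoning
    C : List (Vector ℕ m)
    C = choices m (L' ∘ suc)

  coloursOn-unique : IsClique G S → ∀ {γ} → isProper G γ ≡ true → Unique (coloursOn γ)
  coloursOn-unique clique {γ} proper = unique (Unique.allFin⁺ m)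
    where
    unique : ∀ {js} → Unique js → Unique (map γ (filterᵇ S js))
    unique []                     = []
    unique {j ∷ js} (j≢js ∷ u) with S j in Sj
    ... | false = unique u
    ... | true  = map⁺ (All.zipWith distinct (filter⁺ (T? ∘ S) j≢js , all-filter (T? ∘ S) js)) ∷ unique u
      where
      distinct : ∀ {k} → (j ≢ k) × T (S k) → γ j ≢ γ k
      distinct {k} (j≢k , Sk) = isProper⇒≢ G proper (clique j k Sj (Equivalence.to T-≡ Sk) j≢k)

  coloursOn⊆ : ∀ {γ xs b} → (∀ i → γ i ∈ xs) → b ∈ coloursOn γ → b ∈ xs
  coloursOn⊆ {γ} γ∈xs b∈ with ∈-map⁻ γ b∈
  ... | i , _ , refl = γ∈xs i

  length-coloursOn : ∀ γ → length (coloursOn γ) ≡ ∣ S ∣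
  length-coloursOn γ = length-map γ (filterᵇ S (allFin m))

  count-fresh-coloursOn-≥ : ∀ {xs n} → Unique xs → length xs ≡ n → ∀ γ →
    n ∸ ∣ S ∣ ≤ count (fresh (coloursOn γ)) xs
  count-fresh-coloursOn-≥ {xs} u refl γ = m≤n+o⇒m∸n≤o (length xs) ∣ S ∣
    (subst (λ k → length xs ≤ k + count (fresh (coloursOn γ)) xs) (length-coloursOn γ)
      (length≤length+count-fresh u (coloursOn γ)))

  count-fresh-coloursOn-≤ : IsClique G S → ∀ {xs n γ} → length xs ≡ n → isProper G γ ≡ true →
    (∀ i → γ i ∈ xs) → count (fresh (coloursOn γ)) xs ≤ n ∸ ∣ S ∣
  count-fresh-coloursOn-≤ clique {xs} {γ = γ} refl proper γ∈xs = m+n≤o⇒m≤o∸n _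
    (subst (λ k → count (fresh (coloursOn γ)) xs + k ≤ length xs) (length-coloursOn γ)
      (count-fresh+length≤length (coloursOn-unique clique proper) (coloursOn⊆ γ∈xs)))

length-standard : ∀ n G v → length (standard n G v) ≡ n
length-standard n G v = trans (length-map suc (upTo n)) (length-upTo n)

mainTheorem1 : (n : ℕ) → n ≥ 1 → (G : Graph) → Monophilic n G →
    (S : Fin (size G) → Bool) → IsClique G S →
    Monophilic n (addVertex G S)
mainTheorem1 n _ G monophilic S clique L' isN = begin
  colN G' n
    ≤⟨ col-addVertex-≤ G S (standard n G') (n ∸ ∣ S ∣) (λ γ γ∈ proper →
         count-fresh-coloursOn-≤ G S clique (length-standard n G' zero) proper γ∈) ⟩
  colN G n * (n ∸ ∣ S ∣)
    ≤⟨ *-monoˡ-≤ (n ∸ ∣ S ∣) (monophilic (L' ∘ suc) (isN ∘ suc)) ⟩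
  col G (L' ∘ suc) * (n ∸ ∣ S ∣)
    ≤⟨ col-addVertex-≥ G S L' (n ∸ ∣ S ∣)
         (count-fresh-coloursOn-≥ G S (proj₁ (isN zero)) (proj₂ (isN zero))) ⟩
  col G' L' ∎
  where
  open ≤-Reasoning
  G' : Graph
  G' = addVertex G S
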